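{- Let $n=p_1^{m_1}p_2^{m_2}$, where $p_1<p_2$ are primes and $m_1,m_2\ge 1$ with $m_i>1$ for at least one $i$. Then $$\dim(\mathcal{E}_{\mathbb{Z}_n})=\begin{cases}2m-2, & \text{if } m_1=m\ge 2,\ m_2=1, \text{ or } m_2=m\ge 2,\ m_1=1,\\ m_1m_2+m_1+m_2-4, & \text{if } m_1,m_2>1.\end{cases}$$
   Context: An ideal of a commutative ring $R$ with unity is essential if it has nonzero intersection with every nonzero ideal of $R$. The essential ideal graph $\mathcal{E}_{R}$ is the simple graph whose vertices are the nonzero proper ideals of $R$, distinct $\hat I,\hat J$ adjacent iff $\hat I+\hat J$ is essential. For an ordered set $W=\{w_1,\dots,w_t\}$ of vertices of a connected graph $\Gamma$ and a vertex $v$, $r(v\mid W)=(d(v,w_1),\dots,d(v,w_t))$ with $d$ the graph distance; $W$ is resolving if $r(u\mid W)\ne r(v\mid W)$ for all distinct $u,v\notin W$. The metric dimension $\dim(\Gamma)$ is the minimum size of a resolving set. -}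

module Defs where

open import Data.Nat using (ℕ; zero; suc; _≤_)
open import Data.Nat.DivMod using (_mod_)
open import Data.Fin using (Fin; toℕ)
open import Data.Fin.Subset using (Subset; _∈_; _∉_)
open import Data.Product using (Σ; ∃; _×_; _,_)
open import Data.List using (List; length)
import Data.List.Membership.Propositional as L
open import Data.List.Relation.Unary.All using (All)
open import Data.List.Relation.Unary.Unique.Propositional using (Unique)
open import Relation.Binary.PropositionalEquality using (_≡_; _≢_)
open import Relation.Nullary using (¬_)

_+ₙ_ : ∀ {n} → Fin n → Fin n → Fin n
_+ₙ_ {suc k} a b = (toℕ a Data.Nat.+ toℕ b) mod (suc k)

_*ₙ_ : ∀ {n} → Fin n → Fin n → Fin n
_*ₙ_ {suc k} a b = (toℕ a Data.Nat.* toℕ b) mod (suc k)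

IsZero : ∀ {n} → Fin n → Set
IsZero x = toℕ x ≡ 0

record IsIdeal {n : ℕ} (I : Subset n) : Set where
  field
    zero-mem : ∀ x → IsZero x → x ∈ I
    +-closed : ∀ a b → a ∈ I → b ∈ I → (a +ₙ b) ∈ I
    *-closed : ∀ r a → a ∈ I → (r *ₙ a) ∈ I

NonZeroIdeal : ∀ {n} → Subset n → Set
NonZeroIdeal I = ∃ λ x → x ∈ I × ¬ IsZero x

ProperIdeal : ∀ {n} → Subset n → Set
ProperIdeal I = ∃ λ x → x ∉ I

Essential : ∀ {n} → (Fin n → Set) → Set
Essential {n} K = ∀ (J : Subset n) → IsIdeal J → NonZeroIdeal J →
  ∃ λ x → K x × x ∈ J × ¬ IsZero x

_⊕_ : ∀ {n} → Subset n → Subset n → (Fin n → Set)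
(I ⊕ J) x = ∃ λ a → ∃ λ b → a ∈ I × b ∈ J × (a +ₙ b) ≡ x

-- The essential ideal graph of ℤ_n.
-- Vertices: nonzero proper ideals; vertex-hood is a predicate on Subset n,
-- so that vertex equality is equality of ideals (as subsets).

IsVertex : ∀ {n} → Subset n → Set
IsVertex I = IsIdeal I × NonZeroIdeal I × ProperIdeal I

EAdj : ∀ {n} → Subset n → Subset n → Set
EAdj I J = IsVertex I × IsVertex J × I ≢ J × Essential (I ⊕ J)

module GraphNotions {V : Set} (Vert : V → Set) (Adj : V → V → Set) where

  data Walk : V → V → ℕ → Set where
    here : ∀ {u} → Walk u u 0
    step : ∀ {u w v k} → Adj u w → Walk w v k → Walk u v (suc k)

  Dist : V → V → ℕ → Set
  Dist u v k = Walk u v k × (∀ j → Walk u v j → k ≤ j)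

  Distinguished : List V → V → V → Set
  Distinguished W u v = ∃ λ w → w L.∈ W × ∃ λ k₁ → ∃ λ k₂ →
    Dist u w k₁ × Dist v w k₂ × k₁ ≢ k₂

  Resolving : List V → Set
  Resolving W = All Vert W × Unique W ×
    (∀ u v → Vert u → Vert v → u L.∉ W → v L.∉ W → u ≢ v → Distinguished W u v)

  MetricDim : ℕ → Set
  MetricDim d = (∃ λ W → Resolving W × length W ≡ d) ×
                (∀ W → Resolving W → d ≤ length W)

EssentialIdealGraphDim : ℕ → ℕ → Set
EssentialIdealGraphDim n d = GraphNotions.MetricDim (IsVertex {n}) (EAdj {n}) d

-- Write n = p^A q^B. Every ideal of ℤ_n is generated by a divisor p^i q^j, so the vertices of the
-- essential ideal graph are the exponent pairs (i , j) other than (0 , 0) and (A , B). The minimal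
-- ideals of ℤ_n are generated by n/p and n/q, and I + J is essential iff it contains both of them;
-- hence adjacency of distinct vertices only depends on the profile (i < A , j < B), and vertices of
-- equal profile are twins. A resolving set contains all but at most one vertex of each twin class.
-- There are three classes, the universal vertices (i < A , j < B), the pairs (A , j < B) and the
-- pairs (i < A , B); when B = 1 the single vertex (A , 0) is universal as well, leaving two classes.
-- Since all distances are 1 or 2, dropping one suitable representative per class leaves a resolving
-- set, so the dimension is the number (A + 1)(B + 1) − 2 of vertices minus the number of classes.
module Submission where

open import Defs
open import Data.Nat using (ℕ; suc; _+_; _*_; _∸_; _^_; _≤_; _<_; s≤s; NonZero)
open import Data.Nat.Primality using (Prime; prime⇒nonZero)
open import Data.Nat.Properties using (<⇒≢; m*n≢0; m^n≢0; *-comm)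
open import Data.Product using (_×_; _,_)
open import Data.Sum using (_⊎_)
open import Relation.Binary.PropositionalEquality using (_≡_; _≢_; refl; sym; subst)
open import Relation.Binary.Definitions using (DecidableEquality)
open import Function using (_∘_)

module Lists where

  open import Data.Bool using (true; false)
  open import Data.Nat using (z≤n)
  open import Data.Nat.Properties using (+-suc; module ≤-Reasoning)
  open import Data.List using (List; []; _∷_; length; map; filter; cartesianProduct)
  open import Data.List.Properties using (filter-notAll; length-map; length-++)
  open import Data.List.Membership.Propositional using (_∈_)
  open import Data.List.Membership.Propositional.Properties using (∈-filter⁺; ∈-map⁻)
  open import Data.List.Relation.Binary.Subset.Propositional using (_⊆_)
  open import Data.List.Relation.Unary.All as All using ()
  open import Data.List.Relation.Unary.Any as Any using (here; there)
  open import Data.List.Relation.Unary.AllPairs using ([]; _∷_)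
  open import Data.List.Relation.Unary.Unique.Propositional using (Unique)
  open import Relation.Nullary using (¬?; does)
  open import Relation.Unary using (Pred; Decidable)
  open import Relation.Unary.Properties using (∁?)
  open import Relation.Binary.PropositionalEquality using (trans; cong; cong₂)

  length-cartesianProduct : ∀ {A B : Set} (xs : List A) (ys : List B) →
                            length (cartesianProduct xs ys) ≡ length xs * length ys
  length-cartesianProduct [] ys = refl
  length-cartesianProduct (x ∷ xs) ys =
    trans (length-++ (map (x ,_) ys)) (cong₂ _+_ (length-map (x ,_) ys) (length-cartesianProduct xs ys))

  module _ {A : Set} where

    unique-map⁺ : ∀ {B : Set} (f : A → B) {xs} → (∀ {x y} → x ∈ xs → y ∈ xs → f x ≡ f y → x ≡ y) →
                  Unique xs → Unique (map f xs)
    unique-map⁺ f {[]} _ _ = []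
    unique-map⁺ f {x ∷ xs} injective (x∉xs ∷ xs!) =
      All.tabulate fx∉ ∷ unique-map⁺ f (λ x∈ y∈ → injective (there x∈) (there y∈)) xs!
      where
      fx∉ : ∀ {z} → z ∈ map f xs → f x ≢ z
      fx∉ z∈ refl with y , y∈xs , fx≡fy ← ∈-map⁻ f z∈ =
        All.lookup x∉xs y∈xs (injective (here refl) (there y∈xs) fx≡fy)

    length-filter+∁ : ∀ {ℓ} {P : Pred A ℓ} (P? : Decidable P) xs →
                      length (filter P? xs) + length (filter (∁? P?) xs) ≡ length xs
    length-filter+∁ P? [] = refl
    length-filter+∁ P? (x ∷ xs) with does (P? x)
    ... | true  = cong suc (length-filter+∁ P? xs)
    ... | false = trans (+-suc _ _) (cong suc (length-filter+∁ P? xs))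

    unique-⊆⇒length≤ : DecidableEquality A → ∀ {xs ys} → Unique xs → xs ⊆ ys → length xs ≤ length ys
    unique-⊆⇒length≤ _≟_ {[]} _ _ = z≤n
    unique-⊆⇒length≤ _≟_ {x ∷ xs} {ys} (x∉xs ∷ xs!) x∷xs⊆ys = begin-strict
      length xs               ≤⟨ unique-⊆⇒length≤ _≟_ xs! xs⊆ys-x ⟩
      length (filter ≢x? ys)  <⟨ filter-notAll ≢x? ys (Any.map (λ { refl x≢x → x≢x refl }) (x∷xs⊆ys (here refl))) ⟩
      length ys               ∎
      where
      open ≤-Reasoning
      ≢x? = λ y → ¬? (y ≟ x)
      xs⊆ys-x : xs ⊆ filter ≢x? ys
      xs⊆ys-x y∈xs = ∈-filter⁺ ≢x? (x∷xs⊆ys (there y∈xs)) λ { refl → All.lookup x∉xs y∈xs refl }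

module TwinClasses {V : Set} (Vert : V → Set) (Adj : V → V → Set)
                   (_≟_ : DecidableEquality V) (Adj⇒≢ : ∀ {u v} → Adj u v → u ≢ v) where

  open import Data.Nat using (zero; z≤n)
  open import Data.Nat.Properties
    using (≤-refl; ≤-trans; ≤-antisym; n≤1+n; +-comm; +-mono-≤; +-monoʳ-≤; m≤n+o⇒m∸n≤o; m+n≤o⇒m≤o∸n; module ≤-Reasoning)
  open import Data.List using (List; length; map; filter)
  open import Data.List.Properties using (length-map)
  open import Data.List.Membership.Propositional using (_∈_; _∉_)
  open import Data.List.Membership.Propositional.Properties using (∈-filter⁺; ∈-filter⁻; ∈-map⁻)
  open import Data.List.Relation.Binary.Subset.Propositional using (_⊆_)
  open import Data.List.Relation.Unary.All as All using ()
  open import Data.List.Relation.Unary.Unique.Propositional using (Unique)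
  open import Data.List.Relation.Unary.Unique.Propositional.Properties using (filter⁺)
  open import Data.Product using (∃; ∃₂; proj₁; proj₂)
  open import Data.Sum using (inj₁; inj₂)
  open import Data.Empty using (⊥-elim)
  open import Function using (_∘′_)
  open import Relation.Nullary using (¬_; Dec; yes; no)
  open import Relation.Unary.Properties using (∁?)
  open import Relation.Binary.PropositionalEquality using (trans; cong; subst₂)
  open Lists

  open GraphNotions Vert Adj
  open import Data.List.Membership.DecPropositional _≟_ using (_∈?_)

  Twin : V → V → Set
  Twin u v = ∀ x → x ≢ u → x ≢ v → Adj u x → Adj v x

  Resolves : V → V → V → Set
  Resolves w u v = ∃₂ λ k₁ k₂ → Dist u w k₁ × Dist v w k₂ × k₁ ≢ k₂

  resolves-sym : ∀ {w u v} → Resolves w u v → Resolves w v u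
  resolves-sym (k₁ , k₂ , d₁ , d₂ , k₁≢k₂) = k₂ , k₁ , d₂ , d₁ , k₁≢k₂ ∘′ sym

  twin-walk : ∀ {u v w k} → Twin u v → w ≢ u → w ≢ v → Walk u w k → ∃ λ j → j ≤ k × Walk v w j
  twin-walk t w≢u w≢v here = ⊥-elim (w≢u refl)
  twin-walk {v = v} t w≢u w≢v (step {w = x} u~x walk) with x ≟ v
  ... | yes refl = _ , n≤1+n _ , walk
  ... | no x≢v   = _ , ≤-refl , step (t x (λ x≡u → Adj⇒≢ u~x (sym x≡u)) x≢v u~x) walk

  twins-unresolved : ∀ {u v w} → Twin u v → Twin v u → w ≢ u → w ≢ v → ¬ Resolves w u v
  twins-unresolved u→v v→u w≢u w≢v (k₁ , k₂ , (walk₁ , min₁) , (walk₂ , min₂) , k₁≢k₂)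
    with j₂ , j₂≤k₂ , walk₂′ ← twin-walk v→u w≢v w≢u walk₂
       | j₁ , j₁≤k₁ , walk₁′ ← twin-walk u→v w≢u w≢v walk₁
    = k₁≢k₂ (≤-antisym (≤-trans (min₁ j₂ walk₂′) j₂≤k₂) (≤-trans (min₂ j₁ walk₁′) j₁≤k₁))

  resolving-meets-twins : ∀ {W u v} → Resolving W → Vert u → Vert v → u ≢ v →
                          Twin u v → Twin v u → u ∈ W ⊎ v ∈ W
  resolving-meets-twins {W} {u} {v} (_ , _ , resolves) u-vert v-vert u≢v u→v v→u with u ∈? W | v ∈? W
  ... | yes u∈W | _       = inj₁ u∈W
  ... | no _    | yes v∈W = inj₂ v∈W
  ... | no u∉W  | no v∉W
    with w , w∈W , resolution ← resolves u v u-vert v-vert u∉W v∉W u≢v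
    = ⊥-elim (twins-unresolved u→v v→u (λ { refl → u∉W w∈W }) (λ { refl → v∉W w∈W }) resolution)

  adjacent⇒dist₁ : ∀ {u w} → Adj u w → Dist u w 1
  adjacent⇒dist₁ {u} {w} u~w = step u~w here , minimal
    where
    minimal : ∀ j → Walk u w j → 1 ≤ j
    minimal zero here = ⊥-elim (Adj⇒≢ u~w refl)
    minimal (suc j) _ = s≤s z≤n

  commonNeighbour⇒dist₂ : ∀ {u y w} → u ≢ w → ¬ Adj u w → Adj u y → Adj y w → Dist u w 2
  commonNeighbour⇒dist₂ {u} {y} {w} u≢w u≁w u~y y~w = step u~y (step y~w here) , minimal
    where
    minimal : ∀ j → Walk u w j → 2 ≤ j
    minimal zero here = ⊥-elim (u≢w refl)
    minimal (suc zero) (step u~w here) = ⊥-elim (u≁w u~w)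
    minimal (suc (suc j)) _ = s≤s (s≤s z≤n)

  resolves-by-neighbour : ∀ {w u v y} → Adj u w → v ≢ w → ¬ Adj v w → Adj v y → Adj y w → Resolves w u v
  resolves-by-neighbour u~w v≢w v≁w v~y y~w =
    1 , 2 , adjacent⇒dist₁ u~w , commonNeighbour⇒dist₂ v≢w v≁w v~y y~w , λ ()

  -- A resolving set misses at most one vertex of each twin class; conversely, the vertices other than
  -- one representative per class resolve the graph once they resolve every pair of representatives.
  module Partition
    (vertices : List V) (vertices! : Unique vertices)
    (∈vertices⁺ : ∀ {v} → Vert v → v ∈ vertices) (∈vertices⁻ : ∀ {v} → v ∈ vertices → Vert v)
    {K : Set} (_≟ᴷ_ : DecidableEquality K) (class : V → K) (classes : List K) (classes! : Unique classes)
    (class∈ : ∀ {v} → Vert v → class v ∈ classes)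
    (same-class⇒twin : ∀ {u v} → Vert u → Vert v → class u ≡ class v → Twin u v)
    (rep : K → V) (rep-vert : ∀ {c} → c ∈ classes → Vert (rep c))
    (class-rep : ∀ {c} → c ∈ classes → class (rep c) ≡ c)
    (reps-resolved : ∀ {c c′} → c ∈ classes → c′ ∈ classes → c ≢ c′ →
                     ∃ λ w → Vert w × rep (class w) ≢ w × Resolves w (rep c) (rep c′))
    where

    vertices≤classes+resolving : ∀ W → Resolving W → length vertices ≤ length classes + length W
    vertices≤classes+resolving W W-resolving = begin
      length vertices                ≡⟨ sym (length-filter+∁ (_∈? W) vertices) ⟩
      length inside + length outside ≡⟨ +-comm (length inside) (length outside) ⟩
      length outside + length inside ≤⟨ +-mono-≤ outside≤classes inside≤W ⟩
      length classes + length W      ∎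
      where
      open ≤-Reasoning
      inside = filter (_∈? W) vertices
      outside = filter (∁? (_∈? W)) vertices

      ∈outside⁻ : ∀ {v} → v ∈ outside → v ∈ vertices × v ∉ W
      ∈outside⁻ = ∈-filter⁻ (∁? (_∈? W)) {xs = vertices}

      inside≤W : length inside ≤ length W
      inside≤W = unique-⊆⇒length≤ _≟_ (filter⁺ (_∈? W) {vertices} vertices!)
                                      (proj₂ ∘′ ∈-filter⁻ (_∈? W) {xs = vertices})

      class-injective : ∀ {u v} → u ∈ outside → v ∈ outside → class u ≡ class v → u ≡ v
      class-injective {u} {v} u∈ v∈ same with u ≟ v | ∈outside⁻ u∈ | ∈outside⁻ v∈
      ... | yes u≡v | _ | _ = u≡v
      ... | no u≢v | u∈V , u∉W | v∈V , v∉W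
        with resolving-meets-twins W-resolving (∈vertices⁻ u∈V) (∈vertices⁻ v∈V) u≢v
               (same-class⇒twin (∈vertices⁻ u∈V) (∈vertices⁻ v∈V) same)
               (same-class⇒twin (∈vertices⁻ v∈V) (∈vertices⁻ u∈V) (sym same))
      ...   | inj₁ u∈W = ⊥-elim (u∉W u∈W)
      ...   | inj₂ v∈W = ⊥-elim (v∉W v∈W)

      class∈classes : map class outside ⊆ classes
      class∈classes c∈ with v , v∈ , refl ← ∈-map⁻ class c∈ = class∈ (∈vertices⁻ (proj₁ (∈outside⁻ v∈)))

      outside≤classes : length outside ≤ length classes
      outside≤classes = begin
        length outside             ≡⟨ sym (length-map class outside) ⟩
        length (map class outside) ≤⟨ unique-⊆⇒length≤ _≟ᴷ_ (unique-map⁺ class class-injective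
                                        (filter⁺ (∁? (_∈? W)) {vertices} vertices!)) class∈classes ⟩
        length classes             ∎

    IsRep? : ∀ v → Dec (rep (class v) ≡ v)
    IsRep? v = rep (class v) ≟ v

    nonReps : List V
    nonReps = filter (∁? IsRep?) vertices

    nonReps-resolving : Resolving nonReps
    nonReps-resolving =
      All.tabulate (λ v∈ → ∈vertices⁻ (proj₁ (∈-filter⁻ (∁? IsRep?) {xs = vertices} v∈))) ,
      filter⁺ (∁? IsRep?) {vertices} vertices! ,
      distinguished
      where
      isRep : ∀ {v} → Vert v → v ∉ nonReps → rep (class v) ≡ v
      isRep {v} v-vert v∉ with IsRep? v
      ... | yes isRep = isRep
      ... | no notRep = ⊥-elim (v∉ (∈-filter⁺ (∁? IsRep?) (∈vertices⁺ v-vert) notRep))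

      classes-differ : ∀ {u v} (u-vert : Vert u) (v-vert : Vert v) (u∉ : u ∉ nonReps) (v∉ : v ∉ nonReps) →
                       u ≢ v → class u ≢ class v
      classes-differ u-vert v-vert u∉ v∉ u≢v same =
        u≢v (trans (sym (isRep u-vert u∉)) (trans (cong rep same) (isRep v-vert v∉)))

      distinguished : ∀ u v → Vert u → Vert v → u ∉ nonReps → v ∉ nonReps → u ≢ v → Distinguished nonReps u v
      distinguished u v u-vert v-vert u∉ v∉ u≢v
        with w , w-vert , w-notRep , resolution
               ← reps-resolved (class∈ u-vert) (class∈ v-vert) (classes-differ u-vert v-vert u∉ v∉ u≢v)
        = w , ∈-filter⁺ (∁? IsRep?) (∈vertices⁺ w-vert) w-notRep ,
          subst₂ (Resolves w) (isRep u-vert u∉) (isRep v-vert v∉) resolution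

    nonReps+classes≤vertices : length nonReps + length classes ≤ length vertices
    nonReps+classes≤vertices = begin
      length nonReps + length classes ≤⟨ +-monoʳ-≤ (length nonReps) classes≤reps ⟩
      length nonReps + length reps    ≡⟨ +-comm (length nonReps) (length reps) ⟩
      length reps + length nonReps    ≡⟨ length-filter+∁ IsRep? vertices ⟩
      length vertices                 ∎
      where
      open ≤-Reasoning
      reps = filter IsRep? vertices

      rep∈reps : map rep classes ⊆ reps
      rep∈reps v∈ with c , c∈ , refl ← ∈-map⁻ rep v∈ =
        ∈-filter⁺ IsRep? (∈vertices⁺ (rep-vert c∈)) (cong rep (class-rep c∈))

      rep-injective : ∀ {c c′} → c ∈ classes → c′ ∈ classes → rep c ≡ rep c′ → c ≡ c′
      rep-injective c∈ c′∈ same = trans (sym (class-rep c∈)) (trans (cong class same) (class-rep c′∈))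

      classes≤reps : length classes ≤ length reps
      classes≤reps = begin
        length classes           ≡⟨ sym (length-map rep classes) ⟩
        length (map rep classes) ≤⟨ unique-⊆⇒length≤ _≟_ (unique-map⁺ rep rep-injective classes!) rep∈reps ⟩
        length reps              ∎

    metricDim : MetricDim (length vertices ∸ length classes)
    metricDim = (nonReps , nonReps-resolving , ≤-antisym upper lower) , lower-bound
      where
      lower-bound : ∀ W → Resolving W → length vertices ∸ length classes ≤ length W
      lower-bound W W-resolving =
        m≤n+o⇒m∸n≤o (length vertices) (length classes) (vertices≤classes+resolving W W-resolving)
      upper = m+n≤o⇒m≤o∸n (length nonReps) nonReps+classes≤vertices
      lower = lower-bound nonReps nonReps-resolving

module Arithmetic where

  open import Data.Nat
  open import Data.Nat.Properties
  open import Data.Nat.Divisibility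
  open import Data.Nat.Primality
  open import Data.Nat.Coprimality using (Coprime; coprime-divisor)
  open import Data.Product using (∃; ∃₂; _×_; _,_)
  open import Data.Sum using (_⊎_; inj₁; inj₂)
  open import Data.Empty using (⊥-elim)
  open import Relation.Nullary using (¬_; Dec; yes; no)
  open import Relation.Binary.PropositionalEquality
  open import Relation.Binary.Definitions using (tri<; tri≈; tri>)
  open import Function using (case_of_)

  least : ∀ {P : ℕ → Set} → (∀ z → Dec (P z)) → ∀ {m} → P m → ∃ λ z → P z × (∀ w → w < z → ¬ P w)
  least {P} P? {m} Pm with search (suc m)
    where
    search : ∀ b → (∀ z → z < b → ¬ P z) ⊎ ∃ λ z → P z × (∀ w → w < z → ¬ P w)
    search zero = inj₁ λ _ ()
    search (suc b) with search b
    ... | inj₂ found = inj₂ found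
    ... | inj₁ none with P? b
    ...   | yes Pb = inj₂ (b , Pb , none)
    ...   | no ¬Pb = inj₁ λ z z<1+b → case m≤n⇒m<n∨m≡n (s≤s⁻¹ z<1+b) of λ where
              (inj₁ z<b) → none z z<b
              (inj₂ refl) → ¬Pb
  ... | inj₁ none  = ⊥-elim (none m ≤-refl Pm)
  ... | inj₂ found = found

  module PrimePowers {p : ℕ} (p-prime : Prime p) where

    instance
      p≢0 : NonZero p
      p≢0 = prime⇒nonZero p-prime

    p>1 : 1 < p
    p>1 = nonTrivial⇒n>1 p {{prime⇒nonTrivial p-prime}}

    p^≢0 : ∀ i → NonZero (p ^ i)
    p^≢0 i = m^n≢0 p i

    p∤1 : ¬ p ∣ 1
    p∤1 p∣1 = ¬prime[1] (subst Prime (∣1⇒≡1 p∣1) p-prime)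

    p∤⇒coprime : ∀ {e} → ¬ p ∣ e → Coprime e p
    p∤⇒coprime p∤e (d∣e , d∣p) with prime⇒irreducible p-prime d∣p
    ... | inj₁ d≡1   = d≡1
    ... | inj₂ refl = ⊥-elim (p∤e d∣e)

    p^i∣p^j : ∀ {i j} → i ≤ j → p ^ i ∣ p ^ j
    p^i∣p^j {i} {j} i≤j = divides (p ^ (j ∸ i)) (begin
      p ^ j             ≡⟨ cong (p ^_) (sym (m∸n+n≡m i≤j)) ⟩
      p ^ (j ∸ i + i)   ≡⟨ ^-distribˡ-+-* p (j ∸ i) i ⟩
      p ^ (j ∸ i) * p ^ i ∎)
      where open ≡-Reasoning

    ∣p^m*n⇒ : ∀ m n e → e ∣ p ^ m * n → ∃ λ i → i ≤ m × ∃ λ e′ → e ≡ p ^ i * e′ × e′ ∣ n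
    ∣p^m*n⇒ zero n e e∣ = 0 , z≤n , e , sym (*-identityˡ e) , subst (e ∣_) (*-identityˡ n) e∣
    ∣p^m*n⇒ (suc m) n e e∣ with p ∣? e
    ... | yes (divides c refl) with ∣p^m*n⇒ m n c (*-cancelˡ-∣ p p*c∣)
      where
      p*c∣ : p * c ∣ p * (p ^ m * n)
      p*c∣ = subst₂ _∣_ (*-comm c p) (*-assoc p (p ^ m) n) e∣
    ... | i , i≤m , e′ , refl , e′∣n = suc i , s≤s i≤m , e′ , eq , e′∣n
      where
      eq : p ^ i * e′ * p ≡ p * p ^ i * e′
      eq = trans (*-comm (p ^ i * e′) p) (sym (*-assoc p (p ^ i) e′))
    ∣p^m*n⇒ (suc m) n e e∣ | no p∤e
      with i , i≤m , rest ← ∣p^m*n⇒ m n e (coprime-divisor (p∤⇒coprime p∤e) (subst (e ∣_) (*-assoc p (p ^ m) n) e∣))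
      = i , m≤n⇒m≤1+n i≤m , rest

  module TwoPrimes {p q : ℕ} (p-prime : Prime p) (q-prime : Prime q) (p≢q : p ≢ q) where

    open PrimePowers p-prime
    private module Q = PrimePowers q-prime

    p∤q^ : ∀ k → ¬ p ∣ q ^ k
    p∤q^ zero p∣1 = p∤1 p∣1
    p∤q^ (suc k) p∣ with euclidsLemma q (q ^ k) p-prime p∣
    ... | inj₂ p∣q^k = p∤q^ k p∣q^k
    ... | inj₁ p∣q with prime⇒irreducible q-prime p∣q
    ...   | inj₁ p≡1 = ¬prime[1] (subst Prime p≡1 p-prime)
    ...   | inj₂ p≡q = p≢q p≡q

    p^[1+i]*x∤p^i*q^j : ∀ i x j → ¬ p ^ suc i * x ∣ p ^ i * q ^ j
    p^[1+i]*x∤p^i*q^j i x j d = p∤q^ j (∣-trans (m∣m*n x) (*-cancelˡ-∣ (p ^ i) {{p^≢0 i}} d′))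
      where
      d′ : p ^ i * (p * x) ∣ p ^ i * q ^ j
      d′ = subst (_∣ p ^ i * q ^ j) (trans (cong (_* x) (*-comm p (p ^ i))) (*-assoc (p ^ i) p x)) d

    ∣p^a*q^b⇒ : ∀ a b e → e ∣ p ^ a * q ^ b → ∃₂ λ i j → i ≤ a × j ≤ b × e ≡ p ^ i * q ^ j
    ∣p^a*q^b⇒ a b e e∣
      with i , i≤a , e′ , refl , e′∣ ← ∣p^m*n⇒ a (q ^ b) e e∣
      with j , j≤b , e″ , refl , e″∣1 ← Q.∣p^m*n⇒ b 1 e′ (subst (e′ ∣_) (sym (*-identityʳ (q ^ b))) e′∣)
      rewrite ∣1⇒≡1 e″∣1 | *-identityʳ (q ^ j) = i , j , i≤a , j≤b , refl

    p^i*q^j∣p^a*q^b : ∀ {i j a b} → i ≤ a → j ≤ b → p ^ i * q ^ j ∣ p ^ a * q ^ b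
    p^i*q^j∣p^a*q^b i≤a j≤b = *-pres-∣ (p^i∣p^j i≤a) (Q.p^i∣p^j j≤b)

    p-exponent-injective : ∀ i j i′ j′ → p ^ i * q ^ j ≡ p ^ i′ * q ^ j′ → i ≡ i′
    p-exponent-injective i j i′ j′ eq with <-cmp i i′
    ... | tri≈ _ i≡i′ _ = i≡i′
    ... | tri< i<i′ _ _ = ⊥-elim (p^[1+i]*x∤p^i*q^j i 1 j (subst (p ^ suc i * 1 ∣_) (sym eq)
                            (p^i*q^j∣p^a*q^b {b = j′} i<i′ z≤n)))
    ... | tri> _ _ i′<i = ⊥-elim (p^[1+i]*x∤p^i*q^j i′ 1 j′ (subst (p ^ suc i′ * 1 ∣_) eq
                            (p^i*q^j∣p^a*q^b {b = j} i′<i z≤n)))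

  module Cofactor {p q : ℕ} (p-prime : Prime p) (q-prime : Prime q) (p≢q : p ≢ q)
                  (a b n : ℕ) (n≡ : n ≡ p ^ suc a * q ^ suc b) where

    open PrimePowers p-prime
    open TwoPrimes p-prime q-prime p≢q
    private module Q = PrimePowers q-prime

    N₁ : ℕ
    N₁ = p ^ a * q ^ suc b

    n≡p*N₁ : n ≡ p * N₁
    n≡p*N₁ = trans n≡ (*-assoc p (p ^ a) (q ^ suc b))

    N₁∣n : N₁ ∣ n
    N₁∣n = divides p n≡p*N₁

    p^A∣n : p ^ suc a ∣ n
    p^A∣n = subst (p ^ suc a ∣_) (sym n≡) (m∣m*n (q ^ suc b))

    instance
      N₁≢0 : NonZero N₁
      N₁≢0 = m*n≢0 (p ^ a) (q ^ suc b) {{p^≢0 a}} {{Q.p^≢0 (suc b)}}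

    N₁>0 : 0 < N₁
    N₁>0 = >-nonZero⁻¹ N₁

    N₁<n : N₁ < n
    N₁<n = subst (N₁ <_) (trans (*-comm N₁ p) (sym n≡p*N₁)) (m<m*n N₁ p p>1)

    ∤N₁⇒p^A∣ : ∀ e → e ∣ n → ¬ e ∣ N₁ → p ^ suc a ∣ e
    ∤N₁⇒p^A∣ e e∣n e∤N₁ with ∣p^a*q^b⇒ (suc a) (suc b) e (subst (e ∣_) n≡ e∣n)
    ... | i , j , i≤A , j≤B , refl with m≤n⇒m<n∨m≡n i≤A
    ...   | inj₁ i<A  = ⊥-elim (e∤N₁ (p^i*q^j∣p^a*q^b (s≤s⁻¹ i<A) j≤B))
    ...   | inj₂ refl = m∣m*n (q ^ j)

    -- writing x = c * N₁, the factor p of p ^ suc a must divide c, so n ∣ x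
    N₁∣x∧p^A∣x⇒x≡0 : ∀ x → x < n → N₁ ∣ x → p ^ suc a ∣ x → x ≡ 0
    N₁∣x∧p^A∣x⇒x≡0 x x<n (divides c refl) p^A∣x with euclidsLemma c (q ^ suc b) p-prime p∣c*q^B
      where
      p^a*p∣ : p ^ a * p ∣ p ^ a * (c * q ^ suc b)
      p^a*p∣ = subst₂ _∣_ (*-comm p (p ^ a))
                 (trans (cong (c *_) (*-comm (p ^ a) (q ^ suc b)))
                 (trans (sym (*-assoc c (q ^ suc b) (p ^ a))) (*-comm (c * q ^ suc b) (p ^ a)))) p^A∣x
      p∣c*q^B : p ∣ c * q ^ suc b
      p∣c*q^B = *-cancelˡ-∣ (p ^ a) {{p^≢0 a}} p^a*p∣
    ... | inj₂ p∣q^B = ⊥-elim (p∤q^ (suc b) p∣q^B)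
    ... | inj₁ (divides zero refl) = refl
    ... | inj₁ (divides (suc d) refl) = ⊥-elim (<⇒≱ x<n n≤x)
      where
      n≤x : n ≤ suc d * p * N₁
      n≤x = subst (n ≤_) (trans (cong (suc d *_) n≡p*N₁) (sym (*-assoc (suc d) p N₁))) (m≤m+n n (d * n))

module Ideals (k : ℕ) where

  open import Data.Nat
  open import Data.Nat.Properties
  open import Data.Nat.Divisibility
  open import Data.Nat.DivMod
  open import Data.Fin using (Fin; toℕ; fromℕ<) renaming (zero to 0F)
  open import Data.Fin.Properties using (toℕ-fromℕ<; toℕ-injective; toℕ<n)
  open import Data.Fin.Subset using (Subset; _∈_; _∉_)
  open import Data.Fin.Subset.Properties using (_∈?_; ⊆-antisym)
  open import Data.Vec using (tabulate; lookup)
  open import Data.Vec.Properties using (lookup∘tabulate; []=⇒lookup; lookup⇒[]=)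
  open import Data.Bool using (true; false)
  open import Data.Product using (∃; _×_; _,_)
  open import Data.Sum using (_⊎_; inj₁; inj₂)
  open import Data.Empty using (⊥-elim)
  open import Relation.Nullary using (¬_; Dec; yes; no; ¬?)
  open import Relation.Nullary.Decidable using (⌊_⌋; _×-dec_)
  open import Relation.Binary.PropositionalEquality
  open Arithmetic using (least)

  n : ℕ
  n = suc k

  toℕ-+ₙ : ∀ (x y : Fin n) → toℕ (x +ₙ y) ≡ (toℕ x + toℕ y) % n
  toℕ-+ₙ x y = toℕ-fromℕ< _

  toℕ-*ₙ : ∀ (x y : Fin n) → toℕ (x *ₙ y) ≡ (toℕ x * toℕ y) % n
  toℕ-*ₙ x y = toℕ-fromℕ< _

  0F+ₙ : ∀ x → 0F +ₙ x ≡ x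
  0F+ₙ x = toℕ-injective (trans (toℕ-+ₙ 0F x) (m<n⇒m%n≡m (toℕ<n x)))

  +ₙ0F : ∀ x → x +ₙ 0F ≡ x
  +ₙ0F x = toℕ-injective (trans (toℕ-+ₙ x 0F) (trans (cong (_% n) (+-identityʳ (toℕ x))) (m<n⇒m%n≡m (toℕ<n x))))

  ∈⊕⁺ : ∀ {J K x} → IsIdeal J → IsIdeal K → x ∈ J ⊎ x ∈ K → (J ⊕ K) x
  ∈⊕⁺ {x = x} _ K-ideal (inj₁ x∈J) = x , 0F , x∈J , IsIdeal.zero-mem K-ideal 0F refl , +ₙ0F x
  ∈⊕⁺ {x = x} J-ideal _ (inj₂ x∈K) = 0F , x , IsIdeal.zero-mem J-ideal 0F refl , x∈K , 0F+ₙ x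

  ∉⇒lookup≡false : ∀ {x} {J : Subset n} → x ∉ J → lookup J x ≡ false
  ∉⇒lookup≡false {x} {J} x∉J with lookup J x in eq
  ... | true  = ⊥-elim (x∉J (lookup⇒[]= x J eq))
  ... | false = refl

  lookup≡false⇒∉ : ∀ {x} {J : Subset n} → lookup J x ≡ false → x ∉ J
  lookup≡false⇒∉ J[x]≡false x∈J with trans (sym J[x]≡false) ([]=⇒lookup x∈J)
  ... | ()

  lookup-transfer : ∀ {u v K : Subset n} y → lookup u y ≡ lookup v y → y ∈ u ⊎ y ∈ K → y ∈ v ⊎ y ∈ K
  lookup-transfer {v = v} y same (inj₁ y∈u) = inj₁ (lookup⇒[]= y v (trans (sym same) ([]=⇒lookup y∈u)))
  lookup-transfer y same (inj₂ y∈K) = inj₂ y∈K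

  ⟨_⟩ : ℕ → Subset n
  ⟨ d ⟩ = tabulate (λ x → ⌊ d ∣? toℕ x ⌋)

  ∈⟨⟩⁻ : ∀ {d} x → x ∈ ⟨ d ⟩ → d ∣ toℕ x
  ∈⟨⟩⁻ {d} x x∈ with d ∣? toℕ x | trans (sym (lookup∘tabulate (λ x → ⌊ d ∣? toℕ x ⌋) x)) ([]=⇒lookup x∈)
  ... | yes d∣x | _ = d∣x
  ... | no _    | ()

  ∈⟨⟩⁺ : ∀ {d} x → d ∣ toℕ x → x ∈ ⟨ d ⟩
  ∈⟨⟩⁺ {d} x d∣x = lookup⇒[]= x ⟨ d ⟩ (trans (lookup∘tabulate (λ x → ⌊ d ∣? toℕ x ⌋) x) decided)
    where
    decided : ⌊ d ∣? toℕ x ⌋ ≡ true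
    decided with d ∣? toℕ x
    ... | yes _   = refl
    ... | no d∤x = ⊥-elim (d∤x d∣x)

  ∈⟨⟩-fromℕ< : ∀ {d z} (z<n : z < n) → d ∣ z → fromℕ< z<n ∈ ⟨ d ⟩
  ∈⟨⟩-fromℕ< z<n d∣z = ∈⟨⟩⁺ _ (subst (_ ∣_) (sym (toℕ-fromℕ< z<n)) d∣z)

  ⟨⟩-isIdeal : ∀ {d} → d ∣ n → IsIdeal ⟨ d ⟩
  ⟨⟩-isIdeal {d} d∣n = record
    { zero-mem = λ x x≡0 → ∈⟨⟩⁺ x (subst (d ∣_) (sym x≡0) (d ∣0))
    ; +-closed = λ x y x∈ y∈ → ∈⟨⟩⁺ (x +ₙ y) (subst (d ∣_) (sym (toℕ-+ₙ x y))
                   (%-presˡ-∣ (∣m∣n⇒∣m+n (∈⟨⟩⁻ x x∈) (∈⟨⟩⁻ y y∈)) d∣n))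
    ; *-closed = λ r x x∈ → ∈⟨⟩⁺ (r *ₙ x) (subst (d ∣_) (sym (toℕ-*ₙ r x))
                   (%-presˡ-∣ (∣n⇒∣m*n (toℕ r) (∈⟨⟩⁻ x x∈)) d∣n))
    }

  ⟨⟩-isVertex : ∀ {d} → d ∣ n → 1 < d → d < n → IsVertex ⟨ d ⟩
  ⟨⟩-isVertex {d} d∣n 1<d d<n =
    ⟨⟩-isIdeal d∣n ,
    (fromℕ< d<n , ∈⟨⟩-fromℕ< d<n ∣-refl , λ d≡0 → <⇒≢ (<-trans z<s 1<d) (sym (trans (sym (toℕ-fromℕ< d<n)) d≡0))) ,
    (fromℕ< 1<n , λ 1∈ → <⇒≢ 1<d (sym (∣1⇒≡1 (subst (d ∣_) (toℕ-fromℕ< 1<n) (∈⟨⟩⁻ _ 1∈)))))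
    where
    1<n : 1 < n
    1<n = <-trans 1<d d<n

  ⟨⟩-injective : ∀ {d e} → d < n → e < n → ⟨ d ⟩ ≡ ⟨ e ⟩ → d ≡ e
  ⟨⟩-injective {d} {e} d<n e<n ⟨d⟩≡⟨e⟩ = ∣-antisym (generator-∣ e<n (sym ⟨d⟩≡⟨e⟩)) (generator-∣ d<n ⟨d⟩≡⟨e⟩)
    where
    generator-∣ : ∀ {d e} (d<n : d < n) → ⟨ d ⟩ ≡ ⟨ e ⟩ → e ∣ d
    generator-∣ d<n eq = subst (_ ∣_) (toℕ-fromℕ< d<n)
      (∈⟨⟩⁻ _ (subst (fromℕ< d<n ∈_) eq (∈⟨⟩-fromℕ< d<n ∣-refl)))

  infix 4 _∈ᴺ_ _∈ᴺ?_

  _∈ᴺ_ : ℕ → Subset n → Set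
  z ∈ᴺ J = ∃ λ x → toℕ x ≡ z × x ∈ J

  _∈ᴺ?_ : ∀ z J → Dec (z ∈ᴺ J)
  z ∈ᴺ? J with z <? n
  ... | no z≮n = no λ { (x , refl , _) → z≮n (toℕ<n x) }
  ... | yes z<n with fromℕ< z<n ∈? J
  ...   | yes z∈ = yes (fromℕ< z<n , toℕ-fromℕ< z<n , z∈)
  ...   | no z∉ = no λ { (x , refl , x∈) → z∉ (subst (_∈ J) (toℕ-injective (sym (toℕ-fromℕ< z<n))) x∈) }

  0∈ᴺ : ∀ {J} → IsIdeal J → 0 ∈ᴺ J
  0∈ᴺ J-ideal = 0F , refl , IsIdeal.zero-mem J-ideal 0F refl

  ∈ᴺ-+ : ∀ {J} → IsIdeal J → ∀ {a b} → a ∈ᴺ J → b ∈ᴺ J → (a + b) % n ∈ᴺ J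
  ∈ᴺ-+ J-ideal (x , refl , x∈) (y , refl , y∈) = x +ₙ y , toℕ-+ₙ x y , IsIdeal.+-closed J-ideal x y x∈ y∈

  ∈ᴺ-* : ∀ {J} → IsIdeal J → ∀ c {a} → a ∈ᴺ J → (c * a) % n ∈ᴺ J
  ∈ᴺ-* J-ideal c (x , refl , x∈) = (c mod n) *ₙ x , eq , IsIdeal.*-closed J-ideal (c mod n) x x∈
    where
    open ≡-Reasoning
    eq : toℕ ((c mod n) *ₙ x) ≡ (c * toℕ x) % n
    eq = begin
      toℕ ((c mod n) *ₙ x)               ≡⟨ toℕ-*ₙ (c mod n) x ⟩
      (toℕ (c mod n) * toℕ x) % n        ≡⟨ cong (λ z → (z * toℕ x) % n) (toℕ-fromℕ< (m%n<n c n)) ⟩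
      (c % n * toℕ x) % n                ≡⟨ cong (λ z → (c % n * z) % n) (sym (m<n⇒m%n≡m (toℕ<n x))) ⟩
      (c % n * (toℕ x % n)) % n          ≡⟨ sym (%-distribˡ-* c (toℕ x) n) ⟩
      (c * toℕ x) % n                    ∎

  module LeastGenerator {J} (J-ideal : IsIdeal J) {e} (e∈J : e ∈ᴺ J) (e≢0 : e ≢ 0)
                        (e-least : ∀ w → w < e → ¬ (w ∈ᴺ J × w ≢ 0)) where

    instance
      e-nonZero : NonZero e
      e-nonZero = ≢-nonZero e≢0

    e<n : e < n
    e<n = let x , x≡e , _ = e∈J in subst (_< n) x≡e (toℕ<n x)

    -- X % e ≡ X + (n ∸ X / e) * e modulo n, and the right-hand side lies in J.
    %e∈ᴺ : ∀ X → X % n ∈ᴺ J → X / e ≤ n → X % e ∈ᴺ J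
    %e∈ᴺ X X∈J X/e≤n = subst (_∈ᴺ J) eq (∈ᴺ-+ J-ideal X∈J (∈ᴺ-* J-ideal (n ∸ X / e) e∈J))
      where
      open ≡-Reasoning
      q = X / e
      unfolded : X + (n ∸ q) * e ≡ X % e + e * n
      unfolded = begin
        X + (n ∸ q) * e               ≡⟨ cong (_+ (n ∸ q) * e) (m≡m%n+[m/n]*n X e) ⟩
        X % e + q * e + (n ∸ q) * e   ≡⟨ +-assoc (X % e) (q * e) ((n ∸ q) * e) ⟩
        X % e + (q * e + (n ∸ q) * e) ≡⟨ cong (X % e +_) (sym (*-distribʳ-+ e q (n ∸ q))) ⟩
        X % e + (q + (n ∸ q)) * e     ≡⟨ cong (λ z → X % e + z * e) (m+[n∸m]≡n X/e≤n) ⟩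
        X % e + n * e                 ≡⟨ cong (X % e +_) (*-comm n e) ⟩
        X % e + e * n                 ∎
      eq : (X % n + (n ∸ q) * e % n) % n ≡ X % e
      eq = begin
        (X % n + (n ∸ q) * e % n) % n ≡⟨ sym (%-distribˡ-+ X ((n ∸ q) * e) n) ⟩
        (X + (n ∸ q) * e) % n         ≡⟨ cong (_% n) unfolded ⟩
        (X % e + e * n) % n           ≡⟨ [m+kn]%n≡m%n (X % e) e n ⟩
        X % e % n                     ≡⟨ m<n⇒m%n≡m (<-trans (m%n<n X e) e<n) ⟩
        X % e                         ∎

    e∣ : ∀ X → X % n ∈ᴺ J → X / e ≤ n → e ∣ X
    e∣ X X∈J X/e≤n with X % e ≟ 0
    ... | yes X%e≡0 = m%n≡0⇒n∣m X e X%e≡0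
    ... | no X%e≢0  = ⊥-elim (e-least (X % e) (m%n<n X e) (%e∈ᴺ X X∈J X/e≤n , X%e≢0))

    e∣n : e ∣ n
    e∣n = e∣ n (subst (_∈ᴺ J) (sym (n%n≡0 n)) (0∈ᴺ J-ideal)) (m/n≤m n e)

    ∈J⇒e∣ : ∀ x → x ∈ J → e ∣ toℕ x
    ∈J⇒e∣ x x∈ = e∣ (toℕ x) (x , sym (m<n⇒m%n≡m (toℕ<n x)) , x∈) (≤-trans (m/n≤m (toℕ x) e) (<⇒≤ (toℕ<n x)))

    e∣⇒∈J : ∀ x → e ∣ toℕ x → x ∈ J
    e∣⇒∈J x (divides c eq) with y , y≡ , y∈ ← ∈ᴺ-* J-ideal c e∈J =
      subst (_∈ J) (toℕ-injective (trans y≡ (trans (cong (_% n) (sym eq)) (m<n⇒m%n≡m (toℕ<n x))))) y∈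

  ideal-principal : ∀ {J} → IsIdeal J → NonZeroIdeal J → ∃ λ e → e ∣ n × 0 < e × e < n × J ≡ ⟨ e ⟩
  ideal-principal {J} J-ideal (y , y∈ , y≢0)
    with e , (e∈J , e≢0) , e-least ← least (λ z → z ∈ᴺ? J ×-dec ¬? (z ≟ 0)) ((y , refl , y∈) , y≢0)
    = e , e∣n , n≢0⇒n>0 e≢0 , e<n ,
      ⊆-antisym (λ {x} x∈ → ∈⟨⟩⁺ x (∈J⇒e∣ x x∈)) (λ {x} x∈ → e∣⇒∈J x (∈⟨⟩⁻ x x∈))
    where open LeastGenerator J-ideal e∈J e≢0 e-least

module Socle (k : ℕ) {p q : ℕ} (p-prime : Prime p) (q-prime : Prime q) (p≢q : p ≢ q)
             (a b : ℕ) (n≡ : suc k ≡ p ^ suc a * q ^ suc b) where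

  open import Data.Nat
  open import Data.Nat.Properties
  open import Data.Nat.Divisibility
  open import Data.Fin using (Fin; toℕ; fromℕ<)
  open import Data.Fin.Properties using (toℕ-fromℕ<; toℕ<n)
  open import Data.Fin.Subset using (_∈_; _∉_)
  open import Data.Fin.Subset.Properties using (_∈?_)
  open import Data.Product using (_,_)
  open import Data.Sum using (_⊎_; inj₁; inj₂)
  open import Data.Empty using (⊥-elim)
  open import Relation.Nullary using (¬_; yes; no)
  open import Relation.Binary.PropositionalEquality using (trans)
  open Arithmetic
  open Ideals k
  open Cofactor p-prime q-prime p≢q a b n n≡ public

  ν₁ : Fin n
  ν₁ = fromℕ< N₁<n

  ν₁≢0 : ¬ IsZero ν₁
  ν₁≢0 ν₁≡0 = <⇒≢ N₁>0 (sym (trans (sym (toℕ-fromℕ< N₁<n)) ν₁≡0))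

  ν₁∈⟨⟩ : ∀ {d} → d ∣ N₁ → ν₁ ∈ ⟨ d ⟩
  ν₁∈⟨⟩ = ∈⟨⟩-fromℕ< N₁<n

  ν₁∈⟨⟩⁻ : ∀ {d} → ν₁ ∈ ⟨ d ⟩ → d ∣ N₁
  ν₁∈⟨⟩⁻ ν₁∈ = subst (_ ∣_) (toℕ-fromℕ< N₁<n) (∈⟨⟩⁻ ν₁ ν₁∈)

  ν₁∉⇒p^A∣ : ∀ {J} → IsIdeal J → ν₁ ∉ J → ∀ x → x ∈ J → p ^ suc a ∣ toℕ x
  ν₁∉⇒p^A∣ J-ideal ν₁∉J x x∈J with toℕ x ≟ 0
  ... | yes x≡0 = subst (_ ∣_) (sym x≡0) (_ ∣0)
  ... | no x≢0 with e , e∣n , _ , _ , J≡⟨e⟩ ← ideal-principal J-ideal (x , x∈J , x≢0) =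
    ∣-trans (∤N₁⇒p^A∣ e e∣n λ e∣N₁ → ν₁∉J (subst (ν₁ ∈_) (sym J≡⟨e⟩) (ν₁∈⟨⟩ e∣N₁)))
            (∈⟨⟩⁻ x (subst (x ∈_) J≡⟨e⟩ x∈J))

  essential⇒ν₁∈ : ∀ {J K} → IsIdeal J → IsIdeal K → Essential (J ⊕ K) → ν₁ ∈ J ⊎ ν₁ ∈ K
  essential⇒ν₁∈ {J} {K} J-ideal K-ideal essential with ν₁ ∈? J | ν₁ ∈? K
  ... | yes ν₁∈J | _        = inj₁ ν₁∈J
  ... | no _     | yes ν₁∈K = inj₂ ν₁∈K
  ... | no ν₁∉J  | no ν₁∉K
    with x , (y , z , y∈J , z∈K , y+z≡x) , x∈⟨N₁⟩ , x≢0
           ← essential ⟨ N₁ ⟩ (⟨⟩-isIdeal N₁∣n) (ν₁ , ν₁∈⟨⟩ ∣-refl , ν₁≢0)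
    = ⊥-elim (x≢0 (N₁∣x∧p^A∣x⇒x≡0 _ (toℕ<n x) (∈⟨⟩⁻ x x∈⟨N₁⟩) p^A∣x))
    where
    p^A∣x : p ^ suc a ∣ toℕ x
    p^A∣x = subst (λ w → _ ∣ toℕ w) y+z≡x (subst (_ ∣_) (sym (toℕ-+ₙ y z)) (%-presˡ-∣
      (∣m∣n⇒∣m+n (ν₁∉⇒p^A∣ J-ideal ν₁∉J y y∈J) (ν₁∉⇒p^A∣ K-ideal ν₁∉K z z∈K)) p^A∣n))

module EssentialIdealGraph (k : ℕ) {p q : ℕ} (p-prime : Prime p) (q-prime : Prime q) (p≢q : p ≢ q)
                           (a b : ℕ) (n≡ : suc k ≡ p ^ suc a * q ^ suc b) where

  open import Data.Bool using (Bool)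
  import Data.Bool as Bool
  open import Data.Nat using (s≤s⁻¹)
  open import Data.Nat.Properties using (≤-refl; <-irrefl; m≤n⇒m<n∨m≡n)
  open import Data.Nat.Divisibility using (_∣_)
  open import Data.Fin.Subset using (Subset; _∈_)
  open import Data.Product using (proj₁; proj₂)
  open import Data.Sum using (inj₁; inj₂)
  open import Data.Empty using (⊥-elim)
  open import Data.Vec using (lookup)
  open import Data.Vec.Properties using (≡-dec)
  open import Relation.Nullary using (¬_)
  open import Relation.Binary.PropositionalEquality using (trans; cong)

  open Arithmetic
  open Ideals k
  open TwoPrimes p-prime q-prime p≢q
  private
    module Swapped = TwoPrimes q-prime p-prime (p≢q ∘ sym)

  module Socle₁ = Socle k p-prime q-prime p≢q a b n≡
  module Socle₂ = Socle k q-prime p-prime (p≢q ∘ sym) b a (trans n≡ (*-comm (p ^ suc a) (q ^ suc b)))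

  A B : ℕ
  A = suc a
  B = suc b

  open Socle₁ public using (ν₁; N₁)
  open Socle₂ public using () renaming (ν₁ to ν₂; N₁ to N₂)

  ∣N₁ : ∀ {i j} → i < A → j ≤ B → p ^ i * q ^ j ∣ N₁
  ∣N₁ {i} {j} i<A j≤B = p^i*q^j∣p^a*q^b {i} {j} {a} (s≤s⁻¹ i<A) j≤B

  ∣N₂ : ∀ {i j} → i ≤ A → j < B → p ^ i * q ^ j ∣ N₂
  ∣N₂ {i} {j} i≤A j<B =
    subst (_∣ N₂) (*-comm (q ^ j) (p ^ i)) (Swapped.p^i*q^j∣p^a*q^b {j} {i} {b} (s≤s⁻¹ j<B) i≤A)

  ∤N₁ : ∀ j → ¬ p ^ A * q ^ j ∣ N₁
  ∤N₁ j = p^[1+i]*x∤p^i*q^j a (q ^ j) B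

  ∤N₂ : ∀ i → ¬ p ^ i * q ^ B ∣ N₂
  ∤N₂ i d = Swapped.p^[1+i]*x∤p^i*q^j b (p ^ i) A (subst (_∣ N₂) (*-comm (p ^ i) (q ^ B)) d)

  ∣n⇒∣N₁⊎∣N₂ : ∀ {e} → e ∣ n → e < n → e ∣ N₁ ⊎ e ∣ N₂
  ∣n⇒∣N₁⊎∣N₂ {e} e∣n e<n with ∣p^a*q^b⇒ A B e (subst (e ∣_) n≡ e∣n)
  ... | i , j , i≤A , j≤B , refl with m≤n⇒m<n∨m≡n i≤A | m≤n⇒m<n∨m≡n j≤B
  ...   | inj₁ i<A  | _         = inj₁ (∣N₁ i<A j≤B)
  ...   | inj₂ refl | inj₁ j<B  = inj₂ (∣N₂ i≤A j<B)
  ...   | inj₂ refl | inj₂ refl = ⊥-elim (<-irrefl (sym n≡) e<n)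

  -- ⟨ N₁ ⟩ and ⟨ N₂ ⟩ are the minimal ideals of ℤ_n
  nonZeroIdeal⇒ν₁∈⊎ν₂∈ : ∀ {J} → IsIdeal J → NonZeroIdeal J → ν₁ ∈ J ⊎ ν₂ ∈ J
  nonZeroIdeal⇒ν₁∈⊎ν₂∈ J-ideal J≢0 with e , e∣n , _ , e<n , refl ← ideal-principal J-ideal J≢0
    with ∣n⇒∣N₁⊎∣N₂ e∣n e<n
  ... | inj₁ e∣N₁ = inj₁ (Socle₁.ν₁∈⟨⟩ e∣N₁)
  ... | inj₂ e∣N₂ = inj₂ (Socle₂.ν₁∈⟨⟩ e∣N₂)

  Meets : Subset n → Subset n → Set
  Meets J K = (ν₁ ∈ J ⊎ ν₁ ∈ K) × (ν₂ ∈ J ⊎ ν₂ ∈ K)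

  essential⇒meets : ∀ {J K} → IsIdeal J → IsIdeal K → Essential (J ⊕ K) → Meets J K
  essential⇒meets J-ideal K-ideal essential =
    Socle₁.essential⇒ν₁∈ J-ideal K-ideal essential , Socle₂.essential⇒ν₁∈ J-ideal K-ideal essential

  meets⇒essential : ∀ {J K} → IsIdeal J → IsIdeal K → Meets J K → Essential (J ⊕ K)
  meets⇒essential J-ideal K-ideal (ν₁∈ , ν₂∈) L L-ideal L≢0 with nonZeroIdeal⇒ν₁∈⊎ν₂∈ L-ideal L≢0
  ... | inj₁ ν₁∈L = ν₁ , ∈⊕⁺ J-ideal K-ideal ν₁∈ , ν₁∈L , Socle₁.ν₁≢0
  ... | inj₂ ν₂∈L = ν₂ , ∈⊕⁺ J-ideal K-ideal ν₂∈ , ν₂∈L , Socle₂.ν₁≢0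

  EAdj⇒meets : ∀ {J K} → EAdj J K → Meets J K
  EAdj⇒meets ((J-ideal , _) , (K-ideal , _) , _ , essential) = essential⇒meets J-ideal K-ideal essential

  meets⇒EAdj : ∀ {J K} → IsVertex J → IsVertex K → J ≢ K → Meets J K → EAdj J K
  meets⇒EAdj J-vertex K-vertex J≢K meets =
    J-vertex , K-vertex , J≢K , meets⇒essential (proj₁ J-vertex) (proj₁ K-vertex) meets

  _≟ˢ_ : DecidableEquality (Subset n)
  _≟ˢ_ = ≡-dec Bool._≟_

  EAdj⇒≢ : ∀ {J K : Subset n} → EAdj J K → J ≢ K
  EAdj⇒≢ (_ , _ , J≢K , _) = J≢K

  open GraphNotions (IsVertex {n}) (EAdj {n}) public
  open TwinClasses (IsVertex {n}) (EAdj {n}) _≟ˢ_ EAdj⇒≢ public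

  meets-transfer⇒twin : ∀ {u v} → IsVertex v →
                        (∀ {x} → IsVertex x → x ≢ v → Meets u x → Meets v x) → Twin u v
  meets-transfer⇒twin v-vertex transfer x x≢u x≢v u~x@(_ , x-vertex , _) =
    meets⇒EAdj v-vertex x-vertex (x≢v ∘ sym) (transfer x-vertex x≢v (EAdj⇒meets u~x))

  profile : Subset n → Bool × Bool
  profile J = lookup J ν₁ , lookup J ν₂

  same-profile⇒meets : ∀ {u v x} → profile u ≡ profile v → Meets u x → Meets v x
  same-profile⇒meets same (m₁ , m₂) =
    lookup-transfer ν₁ (cong proj₁ same) m₁ , lookup-transfer ν₂ (cong proj₂ same) m₂

module ExponentGraph (k : ℕ) {p q : ℕ} (p-prime : Prime p) (q-prime : Prime q) (p≢q : p ≢ q)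
                     (a b : ℕ) (n≡ : suc k ≡ p ^ suc a * q ^ suc b) where

  open import Data.Nat
  open import Data.Nat.Properties
  open import Data.Nat.Divisibility
  open import Data.Fin.Subset using (Subset; _∈_; _∉_)
  open import Data.Product using (∃; _×_; _,_; proj₁; proj₂)
  open import Data.Sum using (inj₁; inj₂)
  open import Data.Empty using (⊥-elim)
  open import Data.List using (List; length; map; drop; upTo; cartesianProduct; _++_)
  open import Data.List.Properties using (length-++; length-map; length-drop; length-upTo)
  open import Data.List.Membership.Propositional using () renaming (_∈_ to _∈ₗ_)
  open import Data.List.Membership.Propositional.Properties
    using (∈-++⁺ˡ; ∈-++⁺ʳ; ∈-++⁻; ∈-map⁺; ∈-map⁻; ∈-cartesianProduct⁺; ∈-cartesianProduct⁻; ∈-upTo⁺; ∈-upTo⁻)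
  open import Data.List.Relation.Unary.Any using (here; there)
  open import Data.List.Relation.Unary.Unique.Propositional using (Unique)
  import Data.List.Relation.Unary.Unique.Propositional.Properties as Unique
  open import Relation.Nullary using (¬_)
  open import Relation.Binary.PropositionalEquality

  open Lists
  open Arithmetic
  open Ideals k
  open TwoPrimes p-prime q-prime p≢q
  open EssentialIdealGraph k p-prime q-prime p≢q a b n≡ public
  private
    module Swapped = TwoPrimes q-prime p-prime (p≢q ∘ sym)
    module Pow-p = PrimePowers p-prime
    module Pow-q = PrimePowers q-prime

  E : ℕ × ℕ → Subset n
  E (i , j) = ⟨ p ^ i * q ^ j ⟩

  Proper : ℕ × ℕ → Set
  Proper (i , j) = i ≤ A × j ≤ B × (i , j) ≢ (0 , 0) × (i , j) ≢ (A , B)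

  ν₁∈E : ∀ {i j} → i < A → j ≤ B → ν₁ ∈ E (i , j)
  ν₁∈E i<A j≤B = Socle₁.ν₁∈⟨⟩ (∣N₁ i<A j≤B)

  ν₁∉E : ∀ j → ν₁ ∉ E (A , j)
  ν₁∉E j = ∤N₁ j ∘ Socle₁.ν₁∈⟨⟩⁻

  ν₂∈E : ∀ {i j} → i ≤ A → j < B → ν₂ ∈ E (i , j)
  ν₂∈E i≤A j<B = Socle₂.ν₁∈⟨⟩ (∣N₂ i≤A j<B)

  ν₂∉E : ∀ i → ν₂ ∉ E (i , B)
  ν₂∉E i = ∤N₂ i ∘ Socle₂.ν₁∈⟨⟩⁻

  p^i*q^j<n : ∀ {x} → Proper x → p ^ proj₁ x * q ^ proj₂ x < n
  p^i*q^j<n {i , j} (i≤A , j≤B , _ , x≢top) with m≤n⇒m<n∨m≡n i≤A | m≤n⇒m<n∨m≡n j≤B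
  ... | inj₁ i<A  | _         = ≤-<-trans (∣⇒≤ {{Socle₁.N₁≢0}} (∣N₁ i<A j≤B)) Socle₁.N₁<n
  ... | inj₂ refl | inj₁ j<B  = ≤-<-trans (∣⇒≤ {{Socle₂.N₁≢0}} (∣N₂ i≤A j<B)) Socle₂.N₁<n
  ... | inj₂ refl | inj₂ refl = ⊥-elim (x≢top refl)

  1<p^i*q^j : ∀ {i j} → (i , j) ≢ (0 , 0) → 1 < p ^ i * q ^ j
  1<p^i*q^j {zero} {zero} x≢0 = ⊥-elim (x≢0 refl)
  1<p^i*q^j {suc i} {j} _ =
    <-≤-trans Pow-p.p>1 (≤-trans (m≤m*n p (p ^ i) {{Pow-p.p^≢0 i}}) (m≤m*n (p ^ suc i) (q ^ j) {{Pow-q.p^≢0 j}}))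
  1<p^i*q^j {zero} {suc j} _ =
    <-≤-trans Pow-q.p>1 (≤-trans (m≤m*n q (q ^ j) {{Pow-q.p^≢0 j}}) (m≤n*m (q ^ suc j) 1))

  E-vertex : ∀ {x} → Proper x → IsVertex (E x)
  E-vertex {i , j} x-proper@(i≤A , j≤B , x≢0 , _) =
    ⟨⟩-isVertex (subst (p ^ i * q ^ j ∣_) (sym n≡) (p^i*q^j∣p^a*q^b i≤A j≤B)) (1<p^i*q^j x≢0) (p^i*q^j<n x-proper)

  E-injective : ∀ {x y} → Proper x → Proper y → E x ≡ E y → x ≡ y
  E-injective {i , j} {i′ , j′} x-proper y-proper Ex≡Ey
    with ⟨⟩-injective (p^i*q^j<n x-proper) (p^i*q^j<n y-proper) Ex≡Ey
  ... | eq with refl ← p-exponent-injective i j i′ j′ eq =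
    cong (i ,_) (Swapped.p-exponent-injective j i j′ i
                  (trans (*-comm (q ^ j) (p ^ i)) (trans eq (*-comm (p ^ i) (q ^ j′)))))

  vertex⇒E : ∀ {J} → IsVertex J → ∃ λ x → Proper x × J ≡ E x
  vertex⇒E (J-ideal , J≢0 , y , y∉J) with e , e∣n , _ , e<n , refl ← ideal-principal J-ideal J≢0
    with i , j , i≤A , j≤B , refl ← ∣p^a*q^b⇒ A B e (subst (e ∣_) n≡ e∣n)
    = (i , j) , (i≤A , j≤B , x≢0 , x≢top) , refl
    where
    x≢0 : (i , j) ≢ (0 , 0)
    x≢0 refl = y∉J (∈⟨⟩⁺ y (1∣ _))
    x≢top : (i , j) ≢ (A , B)
    x≢top refl = <-irrefl (sym n≡) e<n

  -- drop 1 removes (0 , 0), the head of the product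
  lowerExponents : List (ℕ × ℕ)
  lowerExponents = drop 1 (cartesianProduct (upTo A) (upTo (suc B)))

  upperExponents : List (ℕ × ℕ)
  upperExponents = map (A ,_) (upTo B)

  exponents : List (ℕ × ℕ)
  exponents = lowerExponents ++ upperExponents

  exponents! : Unique exponents
  exponents! = Unique.++⁺ (Unique.drop⁺ 1 (Unique.cartesianProduct⁺ (Unique.upTo⁺ A) (Unique.upTo⁺ (suc B))))
                          (Unique.map⁺ (λ { refl → refl }) (Unique.upTo⁺ B)) disjoint
    where
    disjoint : ∀ {x} → ¬ (x ∈ₗ lowerExponents × x ∈ₗ upperExponents)
    disjoint (x∈ , x∈′) with _ , _ , refl ← ∈-map⁻ (A ,_) x∈′ =
      <-irrefl refl (∈-upTo⁻ (proj₁ (∈-cartesianProduct⁻ (upTo A) (upTo (suc B)) (there x∈))))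

  ∈exponents⁻ : ∀ {x} → x ∈ₗ exponents → Proper x
  ∈exponents⁻ {i , j} x∈ with ∈-++⁻ lowerExponents x∈
  ... | inj₁ x∈lower with i∈ , j∈ ← ∈-cartesianProduct⁻ (upTo A) (upTo (suc B)) (there x∈lower) =
    <⇒≤ (∈-upTo⁻ i∈) , s≤s⁻¹ (∈-upTo⁻ j∈) , x≢0 , λ { refl → <-irrefl refl (∈-upTo⁻ i∈) }
    where
    box! = Unique.cartesianProduct⁺ (Unique.upTo⁺ A) (Unique.upTo⁺ (suc B))
    x≢0 : (i , j) ≢ (0 , 0)
    x≢0 refl = Unique.Unique[x∷xs]⇒x∉xs box! x∈lower
  ... | inj₂ x∈upper with j , j∈ , refl ← ∈-map⁻ (A ,_) x∈upper =
    ≤-refl , <⇒≤ (∈-upTo⁻ j∈) , (λ ()) , λ { refl → <-irrefl refl (∈-upTo⁻ j∈) }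

  ∈exponents⁺ : ∀ {x} → Proper x → x ∈ₗ exponents
  ∈exponents⁺ {i , j} (i≤A , j≤B , x≢0 , x≢top) with m≤n⇒m<n∨m≡n i≤A
  ... | inj₁ i<A with ∈-cartesianProduct⁺ (∈-upTo⁺ i<A) (∈-upTo⁺ (s≤s j≤B))
  ...   | here x≡0   = ⊥-elim (x≢0 x≡0)
  ...   | there x∈lower = ∈-++⁺ˡ x∈lower
  ∈exponents⁺ {i , j} (i≤A , j≤B , x≢0 , x≢top) | inj₂ refl with m≤n⇒m<n∨m≡n j≤B
  ... | inj₁ j<B  = ∈-++⁺ʳ lowerExponents (∈-map⁺ (A ,_) (∈-upTo⁺ j<B))
  ... | inj₂ refl = ⊥-elim (x≢top refl)

  length-exponents : length exponents ≡ B + a * suc B + B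
  length-exponents = begin
    length exponents                                ≡⟨ length-++ lowerExponents {upperExponents} ⟩
    length lowerExponents + length upperExponents   ≡⟨ cong₂ _+_ lower upper ⟩
    B + a * suc B + B                               ∎
    where
    open ≡-Reasoning
    lower : length lowerExponents ≡ B + a * suc B
    lower = trans (length-drop 1 (cartesianProduct (upTo A) (upTo (suc B))))
                  (cong (_∸ 1) (trans (length-cartesianProduct (upTo A) (upTo (suc B)))
                                      (cong₂ _*_ (length-upTo A) (length-upTo (suc B)))))
    upper : length upperExponents ≡ B
    upper = trans (length-map (λ (j : ℕ) → A , j) (upTo B)) (length-upTo B)

  E≢ : ∀ {x y} → Proper x → Proper y → x ≢ y → E x ≢ E y
  E≢ x-proper y-proper x≢y = x≢y ∘ E-injective x-proper y-proper

  E-adj : ∀ {x y} → Proper x → Proper y → x ≢ y → Meets (E x) (E y) → EAdj (E x) (E y)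
  E-adj x-proper y-proper x≢y = meets⇒EAdj (E-vertex x-proper) (E-vertex y-proper) (E≢ x-proper y-proper x≢y)

  vertices : List (Subset n)
  vertices = map E exponents

  vertices! : Unique vertices
  vertices! = unique-map⁺ E (λ x∈ y∈ → E-injective (∈exponents⁻ x∈) (∈exponents⁻ y∈)) exponents!

  ∈vertices⁺ : ∀ {J} → IsVertex J → J ∈ₗ vertices
  ∈vertices⁺ J-vertex with x , x-proper , refl ← vertex⇒E J-vertex = ∈-map⁺ E (∈exponents⁺ x-proper)

  ∈vertices⁻ : ∀ {J} → J ∈ₗ vertices → IsVertex J
  ∈vertices⁻ J∈ with x , x∈ , refl ← ∈-map⁻ E {xs = exponents} J∈ = E-vertex {x} (∈exponents⁻ x∈)

  length-vertices : length vertices ≡ B + a * suc B + B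
  length-vertices = trans (length-map E exponents) length-exponents

module BothExponentsAtLeastTwo (k : ℕ) {p q : ℕ} (p-prime : Prime p) (q-prime : Prime q) (p≢q : p ≢ q)
                               (a b : ℕ) (n≡ : suc k ≡ p ^ suc (suc a) * q ^ suc (suc b)) where

  open import Data.Bool using (Bool; true; false)
  import Data.Bool.Properties as Bool
  open import Data.Nat
  open import Data.Nat.Properties
  open import Data.Nat.Tactic.RingSolver using (solve-∀)
  open import Data.Fin.Subset using (Subset; _∈_)
  open import Function using (_∘_)
  open import Data.Product using (∃; _×_; _,_; proj₁; proj₂)
  open import Data.Product.Properties using (≡-dec)
  open import Data.Sum using (inj₁; inj₂; [_,_])
  open import Data.Empty using (⊥-elim)
  open import Data.List using (List; []; _∷_; length)
  open import Data.List.Membership.Propositional using () renaming (_∈_ to _∈ₗ_)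
  open import Data.List.Relation.Unary.Any using (here; there)
  open import Data.List.Relation.Unary.AllPairs using ([]; _∷_)
  open import Data.List.Relation.Unary.All using ([]; _∷_)
  open import Data.List.Relation.Unary.Unique.Propositional using (Unique)
  open import Data.Vec using (lookup)
  open import Data.Vec.Properties using ([]=⇒lookup)
  open import Relation.Nullary using (¬_)
  open import Relation.Binary.PropositionalEquality hiding ([_])

  open Ideals k using (n; ∉⇒lookup≡false; lookup≡false⇒∉)
  open ExponentGraph k p-prime q-prime p≢q (suc a) (suc b) n≡

  classes : List (Bool × Bool)
  classes = (true , true) ∷ (false , true) ∷ (true , false) ∷ []

  classes! : Unique classes
  classes! = ((λ ()) ∷ (λ ()) ∷ []) ∷ ((λ ()) ∷ []) ∷ [] ∷ []

  profile∈classes : ∀ {J} → IsVertex J → profile J ∈ₗ classes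
  profile∈classes {J} J-vertex with lookup J ν₁ in eq₁ | lookup J ν₂ in eq₂
  ... | true  | true  = here refl
  ... | false | true  = there (here refl)
  ... | true  | false = there (there (here refl))
  ... | false | false with nonZeroIdeal⇒ν₁∈⊎ν₂∈ (proj₁ J-vertex) (proj₁ (proj₂ J-vertex))
  ...   | inj₁ ν₁∈J = ⊥-elim (lookup≡false⇒∉ eq₁ ν₁∈J)
  ...   | inj₂ ν₂∈J = ⊥-elim (lookup≡false⇒∉ eq₂ ν₂∈J)

  -- r₁ is universal, and wᵢ lies in the class of rᵢ and is adjacent to every representative but rᵢ
  r₁ r₂ r₃ w₂ w₃ : ℕ × ℕ
  r₁ = 1 , 0
  r₂ = A , 0
  r₃ = 0 , B
  w₂ = A , 1
  w₃ = 1 , B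

  r₁-proper : Proper r₁
  r₁-proper = s≤s z≤n , z≤n , (λ ()) , (λ ())
  r₂-proper : Proper r₂
  r₂-proper = ≤-refl , z≤n , (λ ()) , (λ ())
  r₃-proper : Proper r₃
  r₃-proper = z≤n , ≤-refl , (λ ()) , (λ ())
  w₂-proper : Proper w₂
  w₂-proper = ≤-refl , s≤s z≤n , (λ ()) , (λ ())
  w₃-proper : Proper w₃
  w₃-proper = s≤s z≤n , ≤-refl , (λ ()) , (λ ())

  ν₁∈r₁ : ν₁ ∈ E r₁
  ν₁∈r₁ = ν₁∈E (s≤s (s≤s z≤n)) z≤n
  ν₂∈r₁ : ν₂ ∈ E r₁
  ν₂∈r₁ = ν₂∈E (s≤s z≤n) (s≤s z≤n)

  rep : Bool × Bool → Subset n
  rep (true , true)  = E r₁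
  rep (false , _)    = E r₂
  rep (true , false) = E r₃

  profile-r₁ : profile (E r₁) ≡ (true , true)
  profile-r₁ = cong₂ _,_ ([]=⇒lookup ν₁∈r₁) ([]=⇒lookup ν₂∈r₁)
  profile-r₂ : profile (E r₂) ≡ (false , true)
  profile-r₂ = cong₂ _,_ (∉⇒lookup≡false (ν₁∉E 0)) ([]=⇒lookup (ν₂∈E ≤-refl (s≤s z≤n)))
  profile-r₃ : profile (E r₃) ≡ (true , false)
  profile-r₃ = cong₂ _,_ ([]=⇒lookup (ν₁∈E (s≤s z≤n) ≤-refl)) (∉⇒lookup≡false (ν₂∉E 0))
  profile-w₂ : profile (E w₂) ≡ (false , true)
  profile-w₂ = cong₂ _,_ (∉⇒lookup≡false (ν₁∉E 1)) ([]=⇒lookup (ν₂∈E ≤-refl (s≤s (s≤s z≤n))))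
  profile-w₃ : profile (E w₃) ≡ (true , false)
  profile-w₃ = cong₂ _,_ ([]=⇒lookup (ν₁∈E (s≤s (s≤s z≤n)) ≤-refl)) (∉⇒lookup≡false (ν₂∉E 1))

  rep-vertex : ∀ {c} → c ∈ₗ classes → IsVertex (rep c)
  rep-vertex (here refl)                 = E-vertex {r₁} r₁-proper
  rep-vertex (there (here refl))         = E-vertex {r₂} r₂-proper
  rep-vertex (there (there (here refl))) = E-vertex {r₃} r₃-proper

  profile-rep : ∀ {c} → c ∈ₗ classes → profile (rep c) ≡ c
  profile-rep (here refl)                 = profile-r₁
  profile-rep (there (here refl))         = profile-r₂
  profile-rep (there (there (here refl))) = profile-r₃

  r₁~ : ∀ {x} → Proper x → x ≢ r₁ → EAdj (E r₁) (E x)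
  r₁~ x-proper x≢r₁ = E-adj r₁-proper x-proper (x≢r₁ ∘ sym) (inj₁ ν₁∈r₁ , inj₁ ν₂∈r₁)

  ~r₁ : ∀ {x} → Proper x → x ≢ r₁ → EAdj (E x) (E r₁)
  ~r₁ x-proper x≢r₁ = E-adj x-proper r₁-proper x≢r₁ (inj₂ ν₁∈r₁ , inj₂ ν₂∈r₁)

  r₂≁w₂ : ¬ EAdj (E r₂) (E w₂)
  r₂≁w₂ r₂~w₂ = [ ν₁∉E 0 , ν₁∉E 1 ] (proj₁ (EAdj⇒meets r₂~w₂))

  r₃≁w₃ : ¬ EAdj (E r₃) (E w₃)
  r₃≁w₃ r₃~w₃ = [ ν₂∉E 0 , ν₂∉E 1 ] (proj₂ (EAdj⇒meets r₃~w₃))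

  r₁r₂-resolved : Resolves (E w₂) (E r₁) (E r₂)
  r₁r₂-resolved = resolves-by-neighbour (r₁~ w₂-proper (λ ())) (E≢ r₂-proper w₂-proper (λ ())) r₂≁w₂
                    (~r₁ r₂-proper (λ ())) (r₁~ w₂-proper (λ ()))

  r₁r₃-resolved : Resolves (E w₃) (E r₁) (E r₃)
  r₁r₃-resolved = resolves-by-neighbour (r₁~ w₃-proper (λ ())) (E≢ r₃-proper w₃-proper (λ ())) r₃≁w₃
                    (~r₁ r₃-proper (λ ())) (r₁~ w₃-proper (λ ()))

  r₃r₂-resolved : Resolves (E w₂) (E r₃) (E r₂)
  r₃r₂-resolved = resolves-by-neighbour r₃~w₂ (E≢ r₂-proper w₂-proper (λ ())) r₂≁w₂
                    (~r₁ r₂-proper (λ ())) (r₁~ w₂-proper (λ ()))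
    where
    r₃~w₂ : EAdj (E r₃) (E w₂)
    r₃~w₂ = E-adj r₃-proper w₂-proper (λ ())
              (inj₁ (ν₁∈E (s≤s z≤n) ≤-refl) , inj₂ (ν₂∈E ≤-refl (s≤s (s≤s z≤n))))

  w₂-notRep : rep (profile (E w₂)) ≢ E w₂
  w₂-notRep = subst (λ c → rep c ≢ E w₂) (sym profile-w₂) (E≢ r₂-proper w₂-proper (λ ()))

  w₃-notRep : rep (profile (E w₃)) ≢ E w₃
  w₃-notRep = subst (λ c → rep c ≢ E w₃) (sym profile-w₃) (E≢ r₃-proper w₃-proper (λ ()))

  reps-resolved : ∀ {c c′} → c ∈ₗ classes → c′ ∈ₗ classes → c ≢ c′ →
                  ∃ λ w → IsVertex w × rep (profile w) ≢ w × Resolves w (rep c) (rep c′)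
  reps-resolved (here refl)                 (here refl)                 c≢c′ = ⊥-elim (c≢c′ refl)
  reps-resolved (there (here refl))         (there (here refl))         c≢c′ = ⊥-elim (c≢c′ refl)
  reps-resolved (there (there (here refl))) (there (there (here refl))) c≢c′ = ⊥-elim (c≢c′ refl)
  reps-resolved (here refl) (there (here refl)) _ =
    E w₂ , E-vertex {w₂} w₂-proper , w₂-notRep , r₁r₂-resolved
  reps-resolved (there (here refl)) (here refl) _ =
    E w₂ , E-vertex {w₂} w₂-proper , w₂-notRep , resolves-sym r₁r₂-resolved
  reps-resolved (here refl) (there (there (here refl))) _ =
    E w₃ , E-vertex {w₃} w₃-proper , w₃-notRep , r₁r₃-resolved
  reps-resolved (there (there (here refl))) (here refl) _ =
    E w₃ , E-vertex {w₃} w₃-proper , w₃-notRep , resolves-sym r₁r₃-resolved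
  reps-resolved (there (there (here refl))) (there (here refl)) _ =
    E w₂ , E-vertex {w₂} w₂-proper , w₂-notRep , r₃r₂-resolved
  reps-resolved (there (here refl)) (there (there (here refl))) _ =
    E w₂ , E-vertex {w₂} w₂-proper , w₂-notRep , resolves-sym r₃r₂-resolved

  open Partition vertices vertices! ∈vertices⁺ ∈vertices⁻ (≡-dec Bool._≟_ Bool._≟_) profile classes classes!
                 profile∈classes (λ _ v-vertex same → meets-transfer⇒twin v-vertex (λ _ _ → same-profile⇒meets same))
                 rep rep-vertex profile-rep reps-resolved

  dimension : MetricDim (A * B + A + B ∸ 4)
  dimension = subst MetricDim count metricDim
    where
    vertex-count : ∀ a b → 1 + (suc (suc b) + suc a * suc (suc (suc b)) + suc (suc b)) ≡
                           suc (suc a) * suc (suc b) + suc (suc a) + suc (suc b)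
    vertex-count = solve-∀
    count : length vertices ∸ 3 ≡ A * B + A + B ∸ 4
    count = trans (cong (_∸ 3) length-vertices) (cong (_∸ 4) (vertex-count a b))

module SecondExponentOne (k : ℕ) {p q : ℕ} (p-prime : Prime p) (q-prime : Prime q) (p≢q : p ≢ q)
                         (a : ℕ) (n≡ : suc k ≡ p ^ suc (suc a) * q ^ 1) where

  open import Data.Bool using (Bool; true; false)
  import Data.Bool.Properties as Bool
  open import Data.Nat
  open import Data.Nat.Properties
  open import Data.Nat.Tactic.RingSolver using (solve-∀)
  open import Data.Fin.Subset using (Subset; _∈_; _∉_)
  open import Data.Fin.Subset.Properties using (_∈?_)
  open import Data.Product using (∃; _×_; _,_; proj₂)
  open import Data.Sum using (inj₁; inj₂; [_,_])
  open import Data.Empty using (⊥-elim)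
  open import Data.List using (List; []; _∷_; length)
  open import Data.List.Membership.Propositional using () renaming (_∈_ to _∈ₗ_)
  open import Data.List.Relation.Unary.Any using (here; there)
  open import Data.List.Relation.Unary.AllPairs using ([]; _∷_)
  open import Data.List.Relation.Unary.All using ([]; _∷_)
  open import Data.List.Relation.Unary.Unique.Propositional using (Unique)
  open import Data.Vec using (lookup)
  open import Data.Vec.Properties using ([]=⇒lookup)
  open import Relation.Nullary using (¬_; yes; no)
  open import Relation.Binary.PropositionalEquality hiding ([_])

  open Ideals k using (n; ∉⇒lookup≡false; lookup-transfer)
  open ExponentGraph k p-prime q-prime p≢q (suc a) 0 n≡

  -- As B = 1, no other vertex misses ν₁, so E (A , 0) is adjacent to every vertex
  -- and hence twin to the universal ones.
  ν₁∉⇒≡E[A,0] : ∀ {J} → IsVertex J → ν₁ ∉ J → J ≡ E (A , 0)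
  ν₁∉⇒≡E[A,0] J-vertex ν₁∉J with (i , j) , (i≤A , j≤1 , _ , x≢top) , refl ← vertex⇒E J-vertex
    with m≤n⇒m<n∨m≡n i≤A | m≤n⇒m<n∨m≡n j≤1
  ... | inj₁ i<A  | _              = ⊥-elim (ν₁∉J (ν₁∈E i<A j≤1))
  ... | inj₂ refl | inj₁ (s≤s z≤n) = refl
  ... | inj₂ refl | inj₂ refl      = ⊥-elim (x≢top refl)

  class : Subset n → Bool
  class J = lookup J ν₂

  classes : List Bool
  classes = true ∷ false ∷ []

  classes! : Unique classes
  classes! = ((λ ()) ∷ []) ∷ [] ∷ []

  class∈classes : ∀ {J} → IsVertex J → class J ∈ₗ classes
  class∈classes {J} _ with class J
  ... | true  = here refl
  ... | false = there (here refl)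

  same-class⇒twin : ∀ {u v} → IsVertex u → IsVertex v → class u ≡ class v → Twin u v
  same-class⇒twin {u} {v} _ v-vertex same = meets-transfer⇒twin v-vertex transfer
    where
    transfer : ∀ {x} → IsVertex x → x ≢ v → Meets u x → Meets v x
    transfer {x} x-vertex x≢v (_ , m₂) with ν₁ ∈? v | ν₁ ∈? x
    ... | yes ν₁∈v | _        = inj₁ ν₁∈v , lookup-transfer ν₂ same m₂
    ... | no _     | yes ν₁∈x = inj₂ ν₁∈x , lookup-transfer ν₂ same m₂
    ... | no ν₁∉v  | no ν₁∉x  = ⊥-elim (x≢v (trans (ν₁∉⇒≡E[A,0] x-vertex ν₁∉x) (sym (ν₁∉⇒≡E[A,0] v-vertex ν₁∉v))))

  -- r₁ is universal, and w lies in the class of r₂ but is adjacent to r₁ only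
  r₁ r₂ w : ℕ × ℕ
  r₁ = 1 , 0
  r₂ = 0 , 1
  w  = 1 , 1

  r₁-proper : Proper r₁
  r₁-proper = s≤s z≤n , z≤n , (λ ()) , (λ ())
  r₂-proper : Proper r₂
  r₂-proper = z≤n , ≤-refl , (λ ()) , (λ ())
  w-proper : Proper w
  w-proper = s≤s z≤n , ≤-refl , (λ ()) , (λ ())

  ν₁∈r₁ : ν₁ ∈ E r₁
  ν₁∈r₁ = ν₁∈E (s≤s (s≤s z≤n)) z≤n
  ν₂∈r₁ : ν₂ ∈ E r₁
  ν₂∈r₁ = ν₂∈E (s≤s z≤n) (s≤s z≤n)

  rep : Bool → Subset n
  rep true  = E r₁
  rep false = E r₂

  rep-vertex : ∀ {c} → c ∈ₗ classes → IsVertex (rep c)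
  rep-vertex (here refl)         = E-vertex {r₁} r₁-proper
  rep-vertex (there (here refl)) = E-vertex {r₂} r₂-proper

  class-rep : ∀ {c} → c ∈ₗ classes → class (rep c) ≡ c
  class-rep (here refl)         = []=⇒lookup ν₂∈r₁
  class-rep (there (here refl)) = ∉⇒lookup≡false (ν₂∉E 0)

  r₁r₂-resolved : Resolves (E w) (E r₁) (E r₂)
  r₁r₂-resolved = resolves-by-neighbour r₁~w (E≢ r₂-proper w-proper (λ ())) r₂≁w r₂~r₁ r₁~w
    where
    r₁~w : EAdj (E r₁) (E w)
    r₁~w = E-adj r₁-proper w-proper (λ ()) (inj₁ ν₁∈r₁ , inj₁ ν₂∈r₁)
    r₂~r₁ : EAdj (E r₂) (E r₁)
    r₂~r₁ = E-adj r₂-proper r₁-proper (λ ()) (inj₂ ν₁∈r₁ , inj₂ ν₂∈r₁)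
    r₂≁w : ¬ EAdj (E r₂) (E w)
    r₂≁w r₂~w = [ ν₂∉E 0 , ν₂∉E 1 ] (proj₂ (EAdj⇒meets r₂~w))

  w-notRep : rep (class (E w)) ≢ E w
  w-notRep = subst (λ c → rep c ≢ E w) (sym (∉⇒lookup≡false (ν₂∉E 1))) (E≢ r₂-proper w-proper (λ ()))

  reps-resolved : ∀ {c c′} → c ∈ₗ classes → c′ ∈ₗ classes → c ≢ c′ →
                  ∃ λ x → IsVertex x × rep (class x) ≢ x × Resolves x (rep c) (rep c′)
  reps-resolved (here refl)         (here refl)         c≢c′ = ⊥-elim (c≢c′ refl)
  reps-resolved (there (here refl)) (there (here refl)) c≢c′ = ⊥-elim (c≢c′ refl)
  reps-resolved (here refl) (there (here refl)) _ =
    E w , E-vertex {w} w-proper , w-notRep , r₁r₂-resolved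
  reps-resolved (there (here refl)) (here refl) _ =
    E w , E-vertex {w} w-proper , w-notRep , resolves-sym r₁r₂-resolved

  open Partition vertices vertices! ∈vertices⁺ ∈vertices⁻ Bool._≟_ class classes classes!
                 class∈classes same-class⇒twin rep rep-vertex class-rep reps-resolved

  dimension : MetricDim (2 * A ∸ 2)
  dimension = subst MetricDim count metricDim
    where
    vertex-count : ∀ a → 1 + suc a * 2 + 1 ≡ 2 * suc (suc a)
    vertex-count = solve-∀
    count : length vertices ∸ 2 ≡ 2 * A ∸ 2
    count = cong (_∸ 2) (trans length-vertices (vertex-count a))

-- the ring operations of Defs only compute on Fin (suc k)
essentialIdealGraphDim-suc : ∀ {N d} → .{{NonZero N}} →
                             (∀ k → suc k ≡ N → EssentialIdealGraphDim (suc k) d) → EssentialIdealGraphDim N d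
essentialIdealGraphDim-suc {suc k} dim = dim k refl

module _ {p q : ℕ} (p-prime : Prime p) (q-prime : Prime q) (p≢q : p ≢ q) where

  p^i*q^j≢0 : ∀ i j → NonZero (p ^ i * q ^ j)
  p^i*q^j≢0 i j = m*n≢0 (p ^ i) (q ^ j) {{m^n≢0 p i {{prime⇒nonZero p-prime}}}}
                                        {{m^n≢0 q j {{prime⇒nonZero q-prime}}}}

  dim-both-exponents-≥2 : ∀ a b → let m₁ = suc (suc a); m₂ = suc (suc b) in
                          EssentialIdealGraphDim (p ^ m₁ * q ^ m₂) (m₁ * m₂ + m₁ + m₂ ∸ 4)
  dim-both-exponents-≥2 a b = essentialIdealGraphDim-suc {{p^i*q^j≢0 (suc (suc a)) (suc (suc b))}} λ k n≡ →
    BothExponentsAtLeastTwo.dimension k p-prime q-prime p≢q a b n≡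

  dim-second-exponent-one : ∀ a → let m₁ = suc (suc a) in
                            EssentialIdealGraphDim (p ^ m₁ * q ^ 1) (2 * m₁ ∸ 2)
  dim-second-exponent-one a = essentialIdealGraphDim-suc {{p^i*q^j≢0 (suc (suc a)) 1}} λ k n≡ →
    SecondExponentOne.dimension k p-prime q-prime p≢q a n≡

mainTheorem9 : (p₁ p₂ m₁ m₂ : ℕ) → Prime p₁ → Prime p₂ → p₁ < p₂ →
    1 ≤ m₁ → 1 ≤ m₂ → (2 ≤ m₁ ⊎ 2 ≤ m₂) →
    ((2 ≤ m₁ → m₂ ≡ 1 → EssentialIdealGraphDim (p₁ ^ m₁ * p₂ ^ m₂) (2 * m₁ ∸ 2)) ×
     (2 ≤ m₂ → m₁ ≡ 1 → EssentialIdealGraphDim (p₁ ^ m₁ * p₂ ^ m₂) (2 * m₂ ∸ 2)) ×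
     (2 ≤ m₁ → 2 ≤ m₂ → EssentialIdealGraphDim (p₁ ^ m₁ * p₂ ^ m₂) (m₁ * m₂ + m₁ + m₂ ∸ 4)))
mainTheorem9 p₁ p₂ m₁ m₂ p₁-prime p₂-prime p₁<p₂ _ _ _ = m₂≡1 m₁ m₂ , m₁≡1 m₁ m₂ , both≥2 m₁ m₂
  where
  p₁≢p₂ : p₁ ≢ p₂
  p₁≢p₂ = <⇒≢ p₁<p₂

  m₂≡1 : ∀ m₁ m₂ → 2 ≤ m₁ → m₂ ≡ 1 → EssentialIdealGraphDim (p₁ ^ m₁ * p₂ ^ m₂) (2 * m₁ ∸ 2)
  m₂≡1 (suc (suc a)) _ (s≤s (s≤s _)) refl = dim-second-exponent-one p₁-prime p₂-prime p₁≢p₂ a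

  m₁≡1 : ∀ m₁ m₂ → 2 ≤ m₂ → m₁ ≡ 1 → EssentialIdealGraphDim (p₁ ^ m₁ * p₂ ^ m₂) (2 * m₂ ∸ 2)
  m₁≡1 _ (suc (suc b)) (s≤s (s≤s _)) refl =
    subst (λ N → EssentialIdealGraphDim N (2 * suc (suc b) ∸ 2)) (*-comm (p₂ ^ suc (suc b)) (p₁ ^ 1))
          (dim-second-exponent-one p₂-prime p₁-prime (p₁≢p₂ ∘ sym) b)

  both≥2 : ∀ m₁ m₂ → 2 ≤ m₁ → 2 ≤ m₂ → EssentialIdealGraphDim (p₁ ^ m₁ * p₂ ^ m₂) (m₁ * m₂ + m₁ + m₂ ∸ 4)
  both≥2 (suc (suc a)) (suc (suc b)) (s≤s (s≤s _)) (s≤s (s≤s _)) = dim-both-exponents-≥2 p₁-prime p₂-prime p₁≢p₂ a b
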